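{- Let $\mathbf f$ be a finite sequence over $\{ -1,1\}$ of length at least $2$, and define $$\mathbf g:=\begin{cases}1\,(-x), & \text{if } \mathbf f=1\,1\,x;\\ (-1)\,(-x), & \text{if } \mathbf f=1\,(-1)\,x;\\ (-1)\,x, & \text{if } \mathbf f=(-1)\,1\,x;\\ 1\,x, & \text{if } \mathbf f=(-1)\,(-1)\,x,\end{cases}$$ where $x$ is a (possibly empty) sequence over $\{ -1,1\}$. Then $E_{\mathbf f}[n]+\epsilon_n=2n$ for $1\le n<2^{|\mathbf f|-1}$, where $\epsilon_n=0$ if $P_{\mathbf g}[n]=1$ and $\epsilon_n=1$ if $P_{\mathbf g}[n]=-1$. Furthermore, if $\mathbf f$ is an infinite sequence over $\{ -1,1\}$ and $\mathbf g$ is defined by the same rule (with $x$ infinite), then $E_{\mathbf f}[n]+\epsilon_n=2n$ holds for all $n\ge1$.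
   Context: For a finite sequence $\mathbf f$ over $\{ -1,1\}$ define $P_\epsilon=\epsilon$ (empty) and $P_{\mathbf f a}=P_{\mathbf f}\ a\ (-P_{\mathbf f}^R)$ for $a\in\{ -1,1\}$, where $-x$ negates every entry and $x^R$ is reversal; $|P_{\mathbf f}|=2^{|\mathbf f|}-1$. For an infinite $\mathbf f=f_0f_1\cdots$, $P_{\mathbf f}$ is the unique infinite sequence having every $P_{f_0\cdots f_n}$ as a prefix. Paperfolding sequences are indexed from $1$: $P_{\mathbf f}=P_{\mathbf f}[1]P_{\mathbf f}[2]\cdots$. A run is a maximal block of consecutive identical entries; runs are numbered left to right from $1$, and $E_{\mathbf f}[n]$ is the position of the last entry of the $n$-th run of $P_{\mathbf f}$. -}

module Defs where

open import Data.Sign.Base public using (Sign; +; -; opposite)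
open import Data.Nat using (ℕ; zero; suc; _∸_) renaming (_+_ to _+ℕ_)
open import Data.Bool using (Bool; true; false; if_then_else_)
open import Data.List using (List; []; _∷_; _++_; map; reverse; foldl; upTo)
open import Data.Maybe using (Maybe; just; nothing)
open import Data.Product using (Σ; _×_)
open import Data.Sum using (_⊎_)
open import Relation.Binary.PropositionalEquality using (_≡_)

neg : List Sign → List Sign
neg = map opposite

-- Paperfolding sequence of a finite f:
-- P_ε = ε,  P_{f a} = P_f a (-P_f^R)   (processed left to right)
P : List Sign → List Sign
P = foldl (λ acc a → acc ++ (a ∷ neg (reverse acc))) []

-- 1-indexed lookup; index 0 and indices beyond the length give nothing
_!_ : List Sign → ℕ → Maybe Sign
[] ! _ = nothing
(x ∷ xs) ! zero = nothing
(x ∷ xs) ! suc zero = just x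
(x ∷ xs) ! suc (suc i) = xs ! suc i

prefix : (ℕ → Sign) → ℕ → List Sign
prefix f k = map f (upTo k)

-- Paperfolding sequence of an infinite f, 1-indexed:
-- entry i is the i-th entry of P_{f_0 ... f_{i-1}} (which has length 2^i - 1 ≥ i)
Pinf : (ℕ → Sign) → ℕ → Maybe Sign
Pinf f i = P (prefix f i) ! i

-- a (partial, 1-indexed) sequence: position ↦ entry (nothing = no entry)
Seq : Set
Seq = ℕ → Maybe Sign

sameSign : Sign → Sign → Bool
sameSign + + = true
sameSign - - = true
sameSign _ _ = false

differ : Maybe Sign → Maybe Sign → Bool
differ (just a) (just b) = if sameSign a b then false else true
differ _ _ = false

changesBefore : Seq → ℕ → ℕ
changesBefore s zero = 0
changesBefore s (suc m) = changesBefore s m +ℕ (if differ (s m) (s (suc m)) then 1 else 0)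

-- m is the position of the last entry of the n-th run of s  (i.e. E_s[n] = m):
-- entry m exists, it is the last entry of its run (the sequence ends at m or s[m+1] ≠ s[m]),
-- and exactly n-1 run boundaries occur before position m.
IsRunEnd : Seq → ℕ → ℕ → Set
IsRunEnd s n m =
  Σ Sign (λ a → s m ≡ just a)
  × (s (suc m) ≡ nothing ⊎ differ (s m) (s (suc m)) ≡ true)
  × changesBefore s m ≡ n ∸ 1

eps : Sign → ℕ
eps + = 0
eps - = 1

gFin : Sign → Sign → List Sign → List Sign
gFin + + x = + ∷ neg x
gFin + - x = - ∷ neg x
gFin - + x = - ∷ x
gFin - - x = + ∷ x

gInf : (ℕ → Sign) → ℕ → Sign
gInf f zero with f 0 | f 1
... | + | + = +
... | + | - = -
... | - | + = -
... | - | - = +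
gInf f (suc k) with f 0
... | + = opposite (f (suc (suc k)))
... | - = f (suc (suc k))

-- Prepending a sign a interleaves with the alternating signs: P_{a f} = a P_f[1] (-a) P_f[2] a P_f[3] ...
-- So with u_n := ±a the entry at 2n-1, the window at positions 2n-1, 2n, 2n+1 reads u_n, P_f[n], -u_n:
-- it holds exactly one run boundary, and the n-th run ends at 2n if P_f[n] = u_n and at 2n-1 otherwise.
-- Writing f = a b x, the rule defining g says g = (ab) ((-a) x), whence P_g[n] = u_n P_{b x}[n] is the
-- sign telling the two cases apart.  For infinite f, P_f[i] only depends on f_0 ... f_{i-1}.
module Submission where

open import Defs
open import Data.Nat
  using (ℕ; zero; suc; _*_; _∸_; _^_; _≤_; _<_; z≤n; s≤s; _≤′_; ≤′-reflexive; ≤′-step)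
  renaming (_+_ to _+ℕ_)
open import Data.Nat.Properties
  using (+-suc; +-assoc; +-comm; +-identityʳ; ≤-refl; ≤-reflexive; ≤-trans; m∸n≤m; ≤⇒≤′; ≤′⇒≤; m≤n+m; n≤1+n)
open import Data.Bool using (true; if_then_else_)
open import Data.List using (List; []; _∷_; _++_; _∷ʳ_; length; map; reverse; foldl; upTo; applyUpTo)
open import Data.List.Properties
  using (map-++; map-id; foldl-++; map-applyUpTo; unfold-reverse; ++-assoc;
         length-map; length-reverse; length-applyUpTo; applyUpTo-∷ʳ)
open import Data.Maybe using (Maybe; just; nothing)
import Data.Maybe as Maybe
open import Data.Product using (Σ; _×_; _,_)
open import Data.Sum using (_⊎_; inj₁; inj₂)
open import Data.Sign.Base using () renaming (_*_ to _·_)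
open import Data.Sign.Properties using (opposite-involutive)
open import Relation.Binary.PropositionalEquality
  using (_≡_; refl; sym; trans; cong; cong₂; subst; module ≡-Reasoning)

s·opposite[t]≡opposite[s·t] : ∀ s t → s · opposite t ≡ opposite (s · t)
s·opposite[t]≡opposite[s·t] + t = refl
s·opposite[t]≡opposite[s·t] - t = refl

alternate : Sign → ℕ → Sign
alternate a zero = a
alternate a (suc k) = alternate (opposite a) k

alternate-opposite : ∀ a k → alternate (opposite a) k ≡ opposite (alternate a k)
alternate-opposite a zero = refl
alternate-opposite a (suc k) = alternate-opposite (opposite a) k

alternate-+ : ∀ a m n → alternate a (m +ℕ n) ≡ alternate (alternate a m) n
alternate-+ a zero n = refl
alternate-+ a (suc m) n = alternate-+ (opposite a) m n

alternate-double : ∀ a n → alternate a (n +ℕ n) ≡ a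
alternate-double a zero = refl
alternate-double a (suc n) rewrite +-suc n n =
  trans (alternate-double (opposite (opposite a)) n) (opposite-involutive a)

alternate-alternate : ∀ a n → alternate (alternate a n) n ≡ a
alternate-alternate a n = trans (sym (alternate-+ a n n)) (alternate-double a n)

interleave : Sign → List Sign → List Sign
interleave a [] = a ∷ []
interleave a (y ∷ ys) = a ∷ y ∷ interleave (opposite a) ys

interleave-++ : ∀ a xs y ys →
  interleave a (xs ++ y ∷ ys) ≡ interleave a xs ++ y ∷ interleave (alternate a (suc (length xs))) ys
interleave-++ a [] y ys = refl
interleave-++ a (x ∷ xs) y ys = cong (λ z → a ∷ x ∷ z) (interleave-++ (opposite a) xs y ys)

map-·-interleave : ∀ s c Z → map (s ·_) (interleave c Z) ≡ interleave (s · c) (map (s ·_) Z)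
map-·-interleave s c [] = refl
map-·-interleave s c (z ∷ zs) =
  cong (λ w → s · c ∷ s · z ∷ w)
       (trans (map-·-interleave s (opposite c) zs)
              (cong (λ d → interleave d (map (s ·_) zs)) (s·opposite[t]≡opposite[s·t] s c)))

reverse-interleave : ∀ a X → reverse (interleave a X) ≡ interleave (alternate a (length X)) (reverse X)
reverse-interleave a [] = refl
reverse-interleave a (y ∷ ys) = begin
    reverse (a ∷ y ∷ interleave (opposite a) ys)
  ≡⟨ unfold-reverse a (y ∷ interleave (opposite a) ys) ⟩
    reverse (y ∷ interleave (opposite a) ys) ∷ʳ a
  ≡⟨ cong (_∷ʳ a) (unfold-reverse y (interleave (opposite a) ys)) ⟩
    (reverse (interleave (opposite a) ys) ∷ʳ y) ∷ʳ a
  ≡⟨ cong (λ z → (z ∷ʳ y) ∷ʳ a) (reverse-interleave (opposite a) ys) ⟩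
    (interleave c (reverse ys) ∷ʳ y) ∷ʳ a
  ≡⟨ ++-assoc (interleave c (reverse ys)) (y ∷ []) (a ∷ []) ⟩
    interleave c (reverse ys) ++ y ∷ a ∷ []
  ≡⟨ cong (λ z → interleave c (reverse ys) ++ y ∷ z ∷ []) (sym last≡a) ⟩
    interleave c (reverse ys) ++ y ∷ interleave (alternate c (suc (length (reverse ys)))) []
  ≡⟨ sym (interleave-++ c (reverse ys) y []) ⟩
    interleave c (reverse ys ∷ʳ y)
  ≡⟨ cong (interleave c) (sym (unfold-reverse y ys)) ⟩
    interleave c (reverse (y ∷ ys))
  ∎
  where
  open ≡-Reasoning
  c = alternate (opposite a) (length ys)
  last≡a : alternate c (suc (length (reverse ys))) ≡ a
  last≡a rewrite length-reverse ys | alternate-opposite a (length ys)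
               | opposite-involutive (alternate a (length ys)) = alternate-alternate a (length ys)

foldStep : List Sign → Sign → List Sign
foldStep acc a = acc ++ a ∷ neg (reverse acc)

foldStep-interleave : ∀ a X b → foldStep (interleave a X) b ≡ interleave a (foldStep X b)
foldStep-interleave a X b = begin
    interleave a X ++ b ∷ neg (reverse (interleave a X))
  ≡⟨ cong (λ z → interleave a X ++ b ∷ neg z) (reverse-interleave a X) ⟩
    interleave a X ++ b ∷ neg (interleave (alternate a (length X)) (reverse X))
  ≡⟨ cong (λ z → interleave a X ++ b ∷ z) (map-·-interleave - (alternate a (length X)) (reverse X)) ⟩
    interleave a X ++ b ∷ interleave (opposite (alternate a (length X))) (neg (reverse X))
  ≡⟨ cong (λ z → interleave a X ++ b ∷ interleave z (neg (reverse X))) (sym (alternate-opposite a (length X))) ⟩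
    interleave a X ++ b ∷ interleave (alternate a (suc (length X))) (neg (reverse X))
  ≡⟨ sym (interleave-++ a X b (neg (reverse X))) ⟩
    interleave a (foldStep X b)
  ∎
  where open ≡-Reasoning

foldl-foldStep-interleave : ∀ a X ys → foldl foldStep (interleave a X) ys ≡ interleave a (foldl foldStep X ys)
foldl-foldStep-interleave a X [] = refl
foldl-foldStep-interleave a X (y ∷ ys) =
  trans (cong (λ z → foldl foldStep z ys) (foldStep-interleave a X y))
        (foldl-foldStep-interleave a (foldStep X y) ys)

P-∷ : ∀ a f → P (a ∷ f) ≡ interleave a (P f)
P-∷ a f = foldl-foldStep-interleave a [] f

P-∷ʳ : ∀ f b → P (f ∷ʳ b) ≡ foldStep (P f) b
P-∷ʳ f b = foldl-++ foldStep [] f (b ∷ [])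

P-map-· : ∀ s f → P (map (s ·_) f) ≡ map (s ·_) (P f)
P-map-· s [] = refl
P-map-· s (a ∷ f) = begin
    P (s · a ∷ map (s ·_) f)
  ≡⟨ P-∷ (s · a) (map (s ·_) f) ⟩
    interleave (s · a) (P (map (s ·_) f))
  ≡⟨ cong (interleave (s · a)) (P-map-· s f) ⟩
    interleave (s · a) (map (s ·_) (P f))
  ≡⟨ sym (map-·-interleave s a (P f)) ⟩
    map (s ·_) (interleave a (P f))
  ≡⟨ cong (map (s ·_)) (sym (P-∷ a f)) ⟩
    map (s ·_) (P (a ∷ f))
  ∎
  where open ≡-Reasoning

length-interleave : ∀ a X → suc (length X) ≤ length (interleave a X)
length-interleave a [] = ≤-refl
length-interleave a (y ∷ ys) = s≤s (≤-trans (length-interleave (opposite a) ys) (n≤1+n _))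

length-P : ∀ f → length f ≤ length (P f)
length-P [] = z≤n
length-P (a ∷ f) = subst (λ L → suc (length f) ≤ length L) (sym (P-∷ a f))
                     (≤-trans (s≤s (length-P f)) (length-interleave a (P f)))

twist : Sign → List Sign → List Sign
twist a [] = []
twist a (y ∷ ys) = a · y ∷ twist (opposite a) ys

twist-interleave : ∀ a b X → twist a (interleave b X) ≡ interleave (a · b) (map (opposite a ·_) X)
twist-interleave a b [] = refl
twist-interleave a b (x ∷ xs) rewrite opposite-involutive a =
  cong (λ w → a · b ∷ opposite a · x ∷ w)
       (trans (twist-interleave a (opposite b) xs)
              (cong (λ d → interleave d (map (opposite a ·_) xs)) (s·opposite[t]≡opposite[s·t] a b)))

twist-! : ∀ a Y k → twist a Y ! suc k ≡ Maybe.map (alternate a k ·_) (Y ! suc k)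
twist-! a [] k = refl
twist-! a (y ∷ ys) zero = refl
twist-! a (y ∷ ys) (suc k) = twist-! (opposite a) ys k

gFin≡ : ∀ a b x → gFin a b x ≡ a · b ∷ map (opposite a ·_) x
gFin≡ + + x = refl
gFin≡ + - x = refl
gFin≡ - + x = cong (- ∷_) (sym (map-id x))
gFin≡ - - x = cong (+ ∷_) (sym (map-id x))

P-gFin : ∀ a b x → P (gFin a b x) ≡ twist a (P (b ∷ x))
P-gFin a b x = begin
    P (gFin a b x)
  ≡⟨ cong P (gFin≡ a b x) ⟩
    P (a · b ∷ map (opposite a ·_) x)
  ≡⟨ P-∷ (a · b) (map (opposite a ·_) x) ⟩
    interleave (a · b) (P (map (opposite a ·_) x))
  ≡⟨ cong (interleave (a · b)) (P-map-· (opposite a) x) ⟩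
    interleave (a · b) (map (opposite a ·_) (P x))
  ≡⟨ sym (twist-interleave a b (P x)) ⟩
    twist a (interleave b (P x))
  ≡⟨ cong (twist a) (sym (P-∷ b x)) ⟩
    twist a (P (b ∷ x))
  ∎
  where open ≡-Reasoning

!-just⇒≤length : ∀ Y k {y} → Y ! suc k ≡ just y → suc k ≤ length Y
!-just⇒≤length (x ∷ Y) zero e = s≤s z≤n
!-just⇒≤length (x ∷ Y) (suc k) e = s≤s (!-just⇒≤length Y k e)

≤length⇒!-just : ∀ Y k → suc k ≤ length Y → Σ Sign (λ y → Y ! suc k ≡ just y)
≤length⇒!-just (x ∷ Y) zero _ = x , refl
≤length⇒!-just (x ∷ Y) (suc k) (s≤s p) = ≤length⇒!-just Y k p

interleave-!-odd : ∀ a Y k → k ≤ length Y → interleave a Y ! suc (k +ℕ k) ≡ just (alternate a k)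
interleave-!-odd a [] zero _ = refl
interleave-!-odd a (y ∷ ys) zero _ = refl
interleave-!-odd a (y ∷ ys) (suc k) (s≤s p) rewrite +-suc k k = interleave-!-odd (opposite a) ys k p

interleave-!-even : ∀ a Y k → interleave a Y ! suc (suc (k +ℕ k)) ≡ Y ! suc k
interleave-!-even a [] k = refl
interleave-!-even a (y ∷ ys) zero = refl
interleave-!-even a (y ∷ ys) (suc k) rewrite +-suc k k = interleave-!-even (opposite a) ys k

interleave-window : ∀ a Y k {y} → Y ! suc k ≡ just y →
  let s = interleave a Y !_ ; u = alternate a k in
  s (suc (k +ℕ k)) ≡ just u
  × s (suc (suc (k +ℕ k))) ≡ just y
  × s (suc (suc (suc (k +ℕ k)))) ≡ just (opposite u)
interleave-window a Y k Y[k+1]≡y =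
  interleave-!-odd a Y k (≤-trans (n≤1+n k) k<|Y|) ,
  trans (interleave-!-even a Y k) Y[k+1]≡y ,
  trans (cong (λ z → interleave a Y ! suc (suc z)) (sym (+-suc k k)))
        (trans (interleave-!-odd a Y (suc k) k<|Y|) (cong just (alternate-opposite a k)))
  where k<|Y| = !-just⇒≤length Y k Y[k+1]≡y

boundary : Maybe Sign → Maybe Sign → ℕ
boundary p q = if differ p q then 1 else 0

boundary-detour : ∀ u y → boundary (just u) (just y) +ℕ boundary (just y) (just (opposite u)) ≡ 1
boundary-detour + + = refl
boundary-detour + - = refl
boundary-detour - + = refl
boundary-detour - - = refl

changesBefore-detour : ∀ (s : Seq) m {u y} →
  s (suc m) ≡ just u → s (suc (suc m)) ≡ just y → s (suc (suc (suc m))) ≡ just (opposite u) →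
  changesBefore s (suc (suc (suc m))) ≡ suc (changesBefore s (suc m))
changesBefore-detour s m {u} {y} e₁ e₂ e₃ = begin
    (C +ℕ boundary (s (suc m)) (s (suc (suc m)))) +ℕ boundary (s (suc (suc m))) (s (suc (suc (suc m))))
  ≡⟨ cong₂ (λ p q → (C +ℕ boundary p q) +ℕ boundary q (s (suc (suc (suc m))))) e₁ e₂ ⟩
    (C +ℕ boundary (just u) (just y)) +ℕ boundary (just y) (s (suc (suc (suc m))))
  ≡⟨ cong (λ r → (C +ℕ boundary (just u) (just y)) +ℕ boundary (just y) r) e₃ ⟩
    (C +ℕ boundary (just u) (just y)) +ℕ boundary (just y) (just (opposite u))
  ≡⟨ +-assoc C _ _ ⟩
    C +ℕ (boundary (just u) (just y) +ℕ boundary (just y) (just (opposite u)))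
  ≡⟨ cong (C +ℕ_) (boundary-detour u y) ⟩
    C +ℕ 1
  ≡⟨ +-comm C 1 ⟩
    suc C
  ∎
  where
  open ≡-Reasoning
  C = changesBefore s (suc m)

boundary-same : ∀ u → boundary (just u) (just u) ≡ 0
boundary-same + = refl
boundary-same - = refl

changesBefore-constant : ∀ (s : Seq) m {u} → s (suc m) ≡ just u → s (suc (suc m)) ≡ just u →
  changesBefore s (suc (suc m)) ≡ changesBefore s (suc m)
changesBefore-constant s m {u} e₁ e₂ =
  trans (cong₂ (λ p q → changesBefore s (suc m) +ℕ boundary p q) e₁ e₂)
        (trans (cong (changesBefore s (suc m) +ℕ_) (boundary-same u)) (+-identityʳ _))

isRunEnd-detour : ∀ (s : Seq) m k {u y} →
  s (suc m) ≡ just u → s (suc (suc m)) ≡ just y → s (suc (suc (suc m))) ≡ just (opposite u) →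
  changesBefore s (suc m) ≡ k → IsRunEnd s (suc k) (suc (suc m) ∸ eps (u · y))
isRunEnd-detour s m k { + } { + } e₁ e₂ e₃ c =
  (+ , e₂) , inj₂ (cong₂ differ e₂ e₃) , trans (changesBefore-constant s m e₁ e₂) c
isRunEnd-detour s m k { + } { - } e₁ e₂ e₃ c = (+ , e₁) , inj₂ (cong₂ differ e₁ e₂) , c
isRunEnd-detour s m k { - } { + } e₁ e₂ e₃ c = (- , e₁) , inj₂ (cong₂ differ e₁ e₂) , c
isRunEnd-detour s m k { - } { - } e₁ e₂ e₃ c =
  (- , e₂) , inj₂ (cong₂ differ e₂ e₃) , trans (changesBefore-constant s m e₁ e₂) c

changesBefore-interleave : ∀ a Y k → k ≤ length Y → changesBefore (interleave a Y !_) (suc (k +ℕ k)) ≡ k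
changesBefore-interleave a [] zero _ = refl
changesBefore-interleave a (y ∷ ys) zero _ = refl
changesBefore-interleave a Y (suc k) k<|Y| with ≤length⇒!-just Y k k<|Y|
... | y , Y[k+1]≡y with interleave-window a Y k Y[k+1]≡y
... | e₁ , e₂ , e₃ = begin
    changesBefore s (suc (suc k +ℕ suc k))
  ≡⟨ cong (λ z → changesBefore s (suc (suc z))) (+-suc k k) ⟩
    changesBefore s (suc (suc (suc (k +ℕ k))))
  ≡⟨ changesBefore-detour s (k +ℕ k) e₁ e₂ e₃ ⟩
    suc (changesBefore s (suc (k +ℕ k)))
  ≡⟨ cong suc (changesBefore-interleave a Y k (≤-trans (n≤1+n k) k<|Y|)) ⟩
    suc k
  ∎
  where
  open ≡-Reasoning
  s = interleave a Y !_

2*[1+k]≡2+k+k : ∀ k → 2 * suc k ≡ suc (suc (k +ℕ k))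
2*[1+k]≡2+k+k k = cong suc (trans (cong (k +ℕ_) (+-identityʳ (suc k))) (+-suc k k))

interleave-isRunEnd : ∀ a Y k c → twist a Y ! suc k ≡ just c →
  IsRunEnd (interleave a Y !_) (suc k) (2 * suc k ∸ eps c)
interleave-isRunEnd a Y k c e with Y ! suc k in Y[k+1]≡y | trans (sym (twist-! a Y k)) e
... | just y | refl with interleave-window a Y k Y[k+1]≡y
... | e₁ , e₂ , e₃ =
  subst (λ z → IsRunEnd (interleave a Y !_) (suc k) (z ∸ eps (alternate a k · y))) (sym (2*[1+k]≡2+k+k k))
        (isRunEnd-detour (interleave a Y !_) (k +ℕ k) k e₁ e₂ e₃
          (changesBefore-interleave a Y k (≤-trans (n≤1+n k) (!-just⇒≤length Y k Y[k+1]≡y))))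

isRunEnd-finite : ∀ a b x k c → P (gFin a b x) ! suc k ≡ just c →
  IsRunEnd (P (a ∷ b ∷ x) !_) (suc k) (2 * suc k ∸ eps c)
isRunEnd-finite a b x k c e =
  subst (λ L → IsRunEnd (L !_) (suc k) (2 * suc k ∸ eps c)) (sym (P-∷ a (b ∷ x)))
        (interleave-isRunEnd a (P (b ∷ x)) k c (trans (cong (_! suc k) (sym (P-gFin a b x))) e))

prefix≡applyUpTo : ∀ (g : ℕ → Sign) n → prefix g n ≡ applyUpTo g n
prefix≡applyUpTo g n = map-applyUpTo (λ i → i) g n

prefix-suc : ∀ (g : ℕ → Sign) n → prefix g (suc n) ≡ prefix g n ∷ʳ g n
prefix-suc g n = trans (cong (map g) (sym (applyUpTo-∷ʳ (λ i → i) n))) (map-++ g (upTo n) (n ∷ []))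

length-prefix : ∀ (g : ℕ → Sign) n → length (prefix g n) ≡ n
length-prefix g n = trans (length-map g (upTo n)) (length-applyUpTo (λ i → i) n)

!-0 : ∀ r → r ! 0 ≡ nothing
!-0 [] = refl
!-0 (x ∷ r) = refl

++-!ˡ : ∀ X r i → i ≤ length X → (X ++ r) ! i ≡ X ! i
++-!ˡ [] r zero _ = !-0 r
++-!ˡ (x ∷ X) r zero _ = refl
++-!ˡ (x ∷ X) r (suc zero) _ = refl
++-!ˡ (x ∷ X) r (suc (suc i)) (s≤s p) = ++-!ˡ X r (suc i) p

Pinf≡P-prefix-! : ∀ (g : ℕ → Sign) {i N} → i ≤′ N → Pinf g i ≡ P (prefix g N) ! i
Pinf≡P-prefix-! g (≤′-reflexive refl) = refl
Pinf≡P-prefix-! g {i} {suc N} (≤′-step i≤N) = begin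
    Pinf g i
  ≡⟨ Pinf≡P-prefix-! g i≤N ⟩
    P (prefix g N) ! i
  ≡⟨ sym (++-!ˡ (P (prefix g N)) _ i i≤|P|) ⟩
    foldStep (P (prefix g N)) (g N) ! i
  ≡⟨ cong (_! i) (sym (P-∷ʳ (prefix g N) (g N))) ⟩
    P (prefix g N ∷ʳ g N) ! i
  ≡⟨ cong (λ L → P L ! i) (sym (prefix-suc g N)) ⟩
    P (prefix g (suc N)) ! i
  ∎
  where
  open ≡-Reasoning
  i≤|P| : i ≤ length (P (prefix g N))
  i≤|P| = ≤-trans (≤′⇒≤ i≤N)
            (subst (_≤ length (P (prefix g N))) (length-prefix g N) (length-P (prefix g N)))

applyUpTo-gInf : ∀ f K → applyUpTo (gInf f) (suc K) ≡ gFin (f 0) (f 1) (applyUpTo (λ i → f (suc (suc i))) K)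
applyUpTo-gInf f K with f 0 | f 1
... | + | + = cong (+ ∷_) (sym (map-applyUpTo (λ i → f (suc (suc i))) opposite K))
... | + | - = cong (- ∷_) (sym (map-applyUpTo (λ i → f (suc (suc i))) opposite K))
... | - | + = refl
... | - | - = refl

changesBefore-cong : ∀ (s t : Seq) m → (∀ i → i ≤ m → s i ≡ t i) →
  changesBefore s m ≡ changesBefore t m
changesBefore-cong s t zero s≗t = refl
changesBefore-cong s t (suc m) s≗t =
  cong₂ _+ℕ_ (changesBefore-cong s t m (λ i i≤m → s≗t i (≤-trans i≤m (n≤1+n m))))
             (cong₂ boundary (s≗t m (n≤1+n m)) (s≗t (suc m) ≤-refl))

isRunEnd-cong : ∀ (s t : Seq) n m → (∀ i → i ≤ suc m → s i ≡ t i) → IsRunEnd s n m → IsRunEnd t n m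
isRunEnd-cong s t n m s≗t ((a , sₘ≡a) , last , c) =
  (a , trans (sym sₘ≡tₘ) sₘ≡a) , last′ last ,
  trans (sym (changesBefore-cong s t m (λ i i≤m → s≗t i (≤-trans i≤m (n≤1+n m))))) c
  where
  sₘ≡tₘ = s≗t m (n≤1+n m)
  sₘ₊₁≡tₘ₊₁ = s≗t (suc m) ≤-refl
  last′ : s (suc m) ≡ nothing ⊎ differ (s m) (s (suc m)) ≡ true →
          t (suc m) ≡ nothing ⊎ differ (t m) (t (suc m)) ≡ true
  last′ (inj₁ e) = inj₁ (trans (sym sₘ₊₁≡tₘ₊₁) e)
  last′ (inj₂ e) = inj₂ (trans (sym (cong₂ differ sₘ≡tₘ sₘ₊₁≡tₘ₊₁)) e)

isRunEnd-infinite : ∀ f k c → Pinf (gInf f) (suc k) ≡ just c → IsRunEnd (Pinf f) (suc k) (2 * suc k ∸ eps c)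
isRunEnd-infinite f k c e =
  isRunEnd-cong (P (f 0 ∷ f 1 ∷ x) !_) (Pinf f) (suc k) m agree
    (isRunEnd-finite (f 0) (f 1) x k c (trans (sym Pg[k+1]) e))
  where
  K = suc (k +ℕ k)
  x = applyUpTo (λ i → f (suc (suc i))) K
  m = 2 * suc k ∸ eps c
  Pg[k+1] : Pinf (gInf f) (suc k) ≡ P (gFin (f 0) (f 1) x) ! suc k
  Pg[k+1] = trans (Pinf≡P-prefix-! (gInf f) (≤⇒≤′ (s≤s (≤-trans (m≤n+m k k) (n≤1+n (k +ℕ k))))))
                  (cong (λ L → P L ! suc k) (trans (prefix≡applyUpTo (gInf f) (suc K)) (applyUpTo-gInf f K)))
  m+1≤K+2 : suc m ≤ suc (suc K)
  m+1≤K+2 = s≤s (≤-trans (m∸n≤m (2 * suc k) (eps c)) (≤-reflexive (2*[1+k]≡2+k+k k)))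
  agree : ∀ i → i ≤ suc m → P (f 0 ∷ f 1 ∷ x) ! i ≡ Pinf f i
  agree i i≤m+1 = sym (trans (Pinf≡P-prefix-! f (≤⇒≤′ (≤-trans i≤m+1 m+1≤K+2)))
                             (cong (λ L → P L ! i) (prefix≡applyUpTo f (suc (suc K)))))

-- The bound on n in the finite case is implied by P_g[n] existing, as |P_g| = 2^(|f|-1) - 1.
theorem3 :
    ((a b : Sign) (x : List Sign) (n : ℕ) → 1 ≤ n → n < 2 ^ (length (a ∷ b ∷ x) ∸ 1) →
       (c : Sign) → P (gFin a b x) ! n ≡ just c →
       IsRunEnd (λ i → P (a ∷ b ∷ x) ! i) n (2 * n ∸ eps c))
    ×
    ((f : ℕ → Sign) (n : ℕ) → 1 ≤ n →
       (c : Sign) → Pinf (gInf f) n ≡ just c →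
       IsRunEnd (Pinf f) n (2 * n ∸ eps c))
theorem3 =
  (λ { a b x (suc k) _ _ c → isRunEnd-finite a b x k c }) ,
  (λ { f (suc k) _ c → isRunEnd-infinite f k c })
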